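{- For every $\alpha\in\mathbb{C}$ and every integer $n\ge0$, $$ {}_{\mathcal{B}}\mathcal{E}_n^{(\alpha)}(x;y)=\sum_{j=0}^{n}\sum_{k\ge0}\binom{n}{j}(x)_k\,\mathcal{S}_2(j,k)\,{}_{\mathcal{B}}\mathcal{E}_{n-j}^{(\alpha)}(y).$$
   Context: For $\alpha\in\mathbb{C}$, the Bell based Euler polynomials of order $\alpha$ are defined by $\sum_{n\ge0}{}_{\mathcal{B}}\mathcal{E}_n^{(\alpha)}(x;y)\frac{t^n}{n!}=\left(\frac{2}{e^t+1}\right)^{\alpha}e^{xt+y(e^t-1)}$, and ${}_{\mathcal{B}}\mathcal{E}_n^{(\alpha)}(y):={}_{\mathcal{B}}\mathcal{E}_n^{(\alpha)}(0;y)$. Here $(x)_k=x(x-1)\cdots(x-k+1)$ is the falling factorial (so that $e^{xt}=\sum_{k\ge0}(x)_k\frac{(e^t-1)^k}{k!}$), and $\mathcal{S}_2(j,k)$ are the Stirling numbers of the second kind, $\sum_{j\ge0}\mathcal{S}_2(j,k)\frac{t^j}{j!}=\frac{(e^t-1)^k}{k!}$ (so $\mathcal{S}_2(j,k)=0$ for $k>j$). -}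

module Defs where

open import Level using (_⊔_) renaming (suc to lsuc)
open import Data.Nat using (ℕ; zero; suc; _∸_)
open import Data.Nat.Combinatorics using (_C_)
open import Algebra.Bundles using (CommutativeRing)

ringFromℕ : ∀ {c ℓ} (R : CommutativeRing c ℓ) → ℕ → CommutativeRing.Carrier R
ringFromℕ R zero    = CommutativeRing.0# R
ringFromℕ R (suc n) = CommutativeRing._+_ R (CommutativeRing.1# R) (ringFromℕ R n)

-- A commutative ℚ-algebra: a commutative ring in which every positive
-- natural number (m+1)·1 is invertible, with inverse inv m = 1/(m+1).
-- ℂ is the instance relevant to the paper.
record QAlgebra c ℓ : Set (lsuc (c ⊔ ℓ)) where
  field
    cring   : CommutativeRing c ℓ
    inv     : ℕ → CommutativeRing.Carrier cring
    inv-inv : ∀ m → CommutativeRing._≈_ cring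
                 (CommutativeRing._*_ cring (ringFromℕ cring (suc m)) (inv m))
                 (CommutativeRing.1# cring)
  open CommutativeRing cring public
  fromℕ : ℕ → Carrier
  fromℕ = ringFromℕ cring

module Ops {c ℓ} (A : QAlgebra c ℓ) where
  open QAlgebra A public

  Σ≤ : ℕ → (ℕ → Carrier) → Carrier
  Σ≤ zero    f = f 0
  Σ≤ (suc n) f = Σ≤ n f + f (suc n)

  Π< : ℕ → (ℕ → Carrier) → Carrier
  Π< zero    f = 1#
  Π< (suc k) f = Π< k f * f k

  falling : Carrier → ℕ → Carrier
  falling z k = Π< k (λ i → z - fromℕ i)

  fact : ℕ → Carrier
  fact k = Π< k (λ i → fromℕ (suc i))

  invFact : ℕ → Carrier
  invFact k = Π< k inv

  -- formal power series in t: coefficient sequences  f n = [t^n] f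
  Series : Set c
  Series = ℕ → Carrier

  oneS : Series
  oneS zero    = 1#
  oneS (suc _) = 0#

  _⊕_ : Series → Series → Series
  (f ⊕ g) n = f n + g n

  _·S_ : Carrier → Series → Series
  (a ·S f) n = a * f n

  _⊛_ : Series → Series → Series
  (f ⊛ g) n = Σ≤ n (λ i → f i * g (n ∸ i))

  powS : Series → ℕ → Series
  powS f zero    = oneS
  powS f (suc k) = f ⊛ powS f k

  linS : Carrier → Series
  linS z 1 = z
  linS z _ = 0#

  expM1 : Series
  expM1 zero    = 0#
  expM1 (suc n) = invFact (suc n)

  -- exp(f) = Σ_k f^k / k!  for f with zero constant term
  -- (the coefficient of t^n only involves k ≤ n)
  expS : Series → Series
  expS f n = Σ≤ n (λ k → invFact k * powS f k n)

  -- 1/(1+v) = Σ_k (-v)^k  for v with zero constant term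
  recip1+ : Series → Series
  recip1+ v n = Σ≤ n (λ k → powS (λ m → - v m) k n)

  binomR : Carrier → ℕ → Carrier
  binomR α k = falling α k * invFact k

  -- w^α = Σ_k binom(α,k) (w-1)^k  for w with constant term 1
  powα : Series → Carrier → Series
  powα w α n = Σ≤ n (λ k → binomR α k * powS (λ m → w m - oneS m) k n)

  -- 2/(e^t+1) = 1/(1 + (e^t-1)/2)
  twoOverEt+1 : Series
  twoOverEt+1 = recip1+ (inv 1 ·S expM1)

  genBE : Carrier → Carrier → Carrier → Series
  genBE α x y = powα twoOverEt+1 α ⊛ expS (linS x ⊕ (y ·S expM1))

  BE : Carrier → ℕ → Carrier → Carrier → Carrier
  BE α n x y = fact n * genBE α x y n

  BE₀ : Carrier → ℕ → Carrier → Carrier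
  BE₀ α n y = BE α n 0# y

  -- Stirling numbers of the second kind via  Σ_j S2(j,k) t^j/j! = (e^t-1)^k/k!
  S2 : ℕ → ℕ → Carrier
  S2 j k = fact j * (invFact k * powS expM1 k j)

  binomN : ℕ → ℕ → Carrier
  binomN n j = fromℕ (n C j)

{-# OPTIONS --safe #-}
module Submission where

-- Expanding e^{xt} as Σₖ (x)ₖ (eᵗ - 1)ᵏ / k!, the generating function factors as
-- (2/(eᵗ + 1))^α e^{y(eᵗ - 1)} · e^{xt}, and the theorem is the coefficient of
-- tⁿ/n! of this product (j! [tʲ] of the second factor is Σₖ (x)ₖ S₂(j,k)).
-- The factorisation is proved with formal derivatives: exp(xt + y(eᵗ - 1)) and
-- the product both solve F′ = (x + y eᵗ) F with constant term 1, which
-- determines F.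

open import Defs
open import Data.Nat as ℕ using (ℕ; zero; suc; _∸_; _≤_; _<_; _≤′_; ≤′-refl; ≤′-step; z≤n; s≤s; _!)
import Data.Nat.Properties as ℕₚ
open import Data.Nat.Combinatorics using (_C_; nCk≡n!/k![n-k]!; k![n∸k]!∣n!)
open import Data.Nat.DivMod using (m*[n/m]≡n)
open import Data.Sum using (inj₁; inj₂)
open import Relation.Binary.PropositionalEquality as ≡ using (_≡_)
import Algebra.Properties.CommutativeSemigroup as CommutativeSemigroupProperties
import Algebra.Properties.Semiring.Mult as SemiringMult
import Relation.Binary.Reasoning.Setoid as ≈-Reasoning

nCk*k![n∸k]!≡n! : ∀ {n k} → k ≤ n → (n C k) ℕ.* (k ! ℕ.* (n ∸ k) !) ≡ n !
nCk*k![n∸k]!≡n! {n} {k} k≤n = ≡.trans (≡.cong (ℕ._* d) (nCk≡n!/k![n-k]! k≤n))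
  (≡.trans (ℕₚ.*-comm _ d) (m*[n/m]≡n (k![n∸k]!∣n! k≤n)))
  where
  d : ℕ
  d = k ! ℕ.* (n ∸ k) !
  instance
    d≢0 : ℕ.NonZero d
    d≢0 = ℕₚ._!*_!≢0 k (n ∸ k)

module _ {c ℓ} (A : QAlgebra c ℓ) where
  open Ops A
  open ≈-Reasoning setoid
  open SemiringMult semiring using (_×_; ×-homo-+; ×1-homo-*)
  open CommutativeSemigroupProperties +-commutativeSemigroup using ()
    renaming (interchange to +-interchange)
  open CommutativeSemigroupProperties *-commutativeSemigroup using ()
    renaming (x∙yz≈y∙xz to *-lcomm; interchange to *-interchange)

  fromℕ≡×1# : ∀ n → fromℕ n ≡ n × 1#
  fromℕ≡×1# zero    = ≡.refl
  fromℕ≡×1# (suc n) = ≡.cong (1# +_) (fromℕ≡×1# n)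

  fromℕ-+ : ∀ m n → fromℕ (m ℕ.+ n) ≈ fromℕ m + fromℕ n
  fromℕ-+ m n rewrite fromℕ≡×1# (m ℕ.+ n) | fromℕ≡×1# m | fromℕ≡×1# n = ×-homo-+ 1# m n

  fromℕ-* : ∀ m n → fromℕ (m ℕ.* n) ≈ fromℕ m * fromℕ n
  fromℕ-* m n rewrite fromℕ≡×1# (m ℕ.* n) | fromℕ≡×1# m | fromℕ≡×1# n = ×1-homo-* m n

  fromℕ-1* : ∀ x → fromℕ 1 * x ≈ x
  fromℕ-1* x = trans (*-congʳ (+-identityʳ 1#)) (*-identityˡ x)

  fact≈fromℕ! : ∀ k → fact k ≈ fromℕ (k !)
  fact≈fromℕ! zero    = sym (+-identityʳ 1#)
  fact≈fromℕ! (suc k) = begin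
    fact k * fromℕ (suc k)        ≈⟨ *-congʳ (fact≈fromℕ! k) ⟩
    fromℕ (k !) * fromℕ (suc k)   ≈⟨ *-comm _ _ ⟩
    fromℕ (suc k) * fromℕ (k !)   ≈⟨ fromℕ-* (suc k) (k !) ⟨
    fromℕ (suc k ℕ.* k !)         ∎

  binomN*fact*fact : ∀ {n j} → j ≤ n → binomN n j * (fact j * fact (n ∸ j)) ≈ fact n
  binomN*fact*fact {n} {j} j≤n = begin
    fromℕ (n C j) * (fact j * fact (n ∸ j))
      ≈⟨ *-congˡ (*-cong (fact≈fromℕ! j) (fact≈fromℕ! (n ∸ j))) ⟩
    fromℕ (n C j) * (fromℕ (j !) * fromℕ ((n ∸ j) !))
      ≈⟨ *-congˡ (fromℕ-* (j !) ((n ∸ j) !)) ⟨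
    fromℕ (n C j) * fromℕ (j ! ℕ.* (n ∸ j) !)
      ≈⟨ fromℕ-* (n C j) (j ! ℕ.* (n ∸ j) !) ⟨
    fromℕ ((n C j) ℕ.* (j ! ℕ.* (n ∸ j) !))
      ≡⟨ ≡.cong fromℕ (nCk*k![n∸k]!≡n! j≤n) ⟩
    fromℕ (n !)
      ≈⟨ fact≈fromℕ! n ⟨
    fact n ∎

  inv-cancelˡ : ∀ k x → inv k * (fromℕ (suc k) * x) ≈ x
  inv-cancelˡ k x = begin
    inv k * (fromℕ (suc k) * x) ≈⟨ *-assoc _ _ _ ⟨
    (inv k * fromℕ (suc k)) * x ≈⟨ *-congʳ (trans (*-comm _ _) (inv-inv k)) ⟩
    1# * x                      ≈⟨ *-identityˡ x ⟩
    x                           ∎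

  invFact-suc-cancelˡ : ∀ k x → invFact (suc k) * (fromℕ (suc k) * x) ≈ invFact k * x
  invFact-suc-cancelˡ k x = trans (*-assoc _ _ _) (*-congˡ (inv-cancelˡ k x))

  fromℕ-suc*invFact-suc : ∀ k → fromℕ (suc k) * invFact (suc k) ≈ invFact k
  fromℕ-suc*invFact-suc k = begin
    fromℕ (suc k) * (invFact k * inv k) ≈⟨ *-lcomm _ _ _ ⟩
    invFact k * (fromℕ (suc k) * inv k) ≈⟨ *-congˡ (inv-inv k) ⟩
    invFact k * 1#                      ≈⟨ *-identityʳ _ ⟩
    invFact k                           ∎

  x*falling : ∀ x k → x * falling x k ≈ falling x (suc k) + fromℕ k * falling x k
  x*falling x k = begin
    x * falling x k                                     ≈⟨ *-comm _ _ ⟩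
    falling x k * x                                     ≈⟨ *-congˡ x-k+k≈x ⟨
    falling x k * ((x - fromℕ k) + fromℕ k)             ≈⟨ distribˡ _ _ _ ⟩
    falling x (suc k) + falling x k * fromℕ k           ≈⟨ +-congˡ (*-comm _ _) ⟩
    falling x (suc k) + fromℕ k * falling x k           ∎
    where
    x-k+k≈x : (x - fromℕ k) + fromℕ k ≈ x
    x-k+k≈x = trans (+-assoc _ _ _) (trans (+-congˡ (-‿inverseˡ _)) (+-identityʳ x))

  Σ≤-cong : ∀ n {f g : ℕ → Carrier} → (∀ i → f i ≈ g i) → Σ≤ n f ≈ Σ≤ n g
  Σ≤-cong zero    f≈g = f≈g 0
  Σ≤-cong (suc n) f≈g = +-cong (Σ≤-cong n f≈g) (f≈g (suc n))

  Σ≤-cong-≤ : ∀ n {f g : ℕ → Carrier} → (∀ {i} → i ≤ n → f i ≈ g i) → Σ≤ n f ≈ Σ≤ n g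
  Σ≤-cong-≤ zero    f≈g = f≈g z≤n
  Σ≤-cong-≤ (suc n) f≈g = +-cong (Σ≤-cong-≤ n (λ i≤n → f≈g (ℕₚ.m≤n⇒m≤1+n i≤n))) (f≈g ℕₚ.≤-refl)

  Σ≤-zero : ∀ n {f : ℕ → Carrier} → (∀ {i} → i ≤ n → f i ≈ 0#) → Σ≤ n f ≈ 0#
  Σ≤-zero zero    f≈0 = f≈0 z≤n
  Σ≤-zero (suc n) f≈0 = trans
    (+-cong (Σ≤-zero n (λ i≤n → f≈0 (ℕₚ.m≤n⇒m≤1+n i≤n))) (f≈0 ℕₚ.≤-refl)) (+-identityʳ 0#)

  Σ≤-distrib-+ : ∀ n (f g : ℕ → Carrier) → Σ≤ n (λ i → f i + g i) ≈ Σ≤ n f + Σ≤ n g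
  Σ≤-distrib-+ zero    f g = refl
  Σ≤-distrib-+ (suc n) f g = trans (+-congʳ (Σ≤-distrib-+ n f g)) (+-interchange _ _ _ _)

  *-distribˡ-Σ≤ : ∀ n a (f : ℕ → Carrier) → a * Σ≤ n f ≈ Σ≤ n (λ i → a * f i)
  *-distribˡ-Σ≤ zero    a f = refl
  *-distribˡ-Σ≤ (suc n) a f = trans (distribˡ a _ _) (+-congʳ (*-distribˡ-Σ≤ n a f))

  *-distribʳ-Σ≤ : ∀ n a (f : ℕ → Carrier) → Σ≤ n f * a ≈ Σ≤ n (λ i → f i * a)
  *-distribʳ-Σ≤ n a f =
    trans (*-comm _ a) (trans (*-distribˡ-Σ≤ n a f) (Σ≤-cong n (λ i → *-comm a (f i))))

  Σ≤-head : ∀ n (f : ℕ → Carrier) → Σ≤ (suc n) f ≈ f 0 + Σ≤ n (λ i → f (suc i))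
  Σ≤-head zero    f = refl
  Σ≤-head (suc n) f = trans (+-congʳ (Σ≤-head n f)) (+-assoc _ _ _)

  Σ≤-extend : ∀ {n m} (f : ℕ → Carrier) → n ≤ m → (∀ {i} → n < i → f i ≈ 0#) → Σ≤ m f ≈ Σ≤ n f
  Σ≤-extend {n} f n≤m f≈0 = extend (ℕₚ.≤⇒≤′ n≤m)
    where
    extend : ∀ {m} → n ≤′ m → Σ≤ m f ≈ Σ≤ n f
    extend ≤′-refl          = refl
    extend (≤′-step n≤′m) =
      trans (+-cong (extend n≤′m) (f≈0 (s≤s (ℕₚ.≤′⇒≤ n≤′m)))) (+-identityʳ _)

  Σ≤-reverse : ∀ n (f : ℕ → Carrier) → Σ≤ n f ≈ Σ≤ n (λ i → f (n ∸ i))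
  Σ≤-reverse zero    f = refl
  Σ≤-reverse (suc n) f = begin
    Σ≤ n f + f (suc n)                   ≈⟨ +-congʳ (Σ≤-reverse n f) ⟩
    Σ≤ n (λ i → f (n ∸ i)) + f (suc n)   ≈⟨ +-comm _ _ ⟩
    f (suc n) + Σ≤ n (λ i → f (n ∸ i))   ≈⟨ Σ≤-head n (λ i → f (suc n ∸ i)) ⟨
    Σ≤ (suc n) (λ i → f (suc n ∸ i))     ∎

  Σ≤-swap : ∀ n m (F : ℕ → ℕ → Carrier) →
    Σ≤ n (λ i → Σ≤ m (λ j → F i j)) ≈ Σ≤ m (λ j → Σ≤ n (λ i → F i j))
  Σ≤-swap zero    m F = refl
  Σ≤-swap (suc n) m F = begin
    Σ≤ n (λ i → Σ≤ m (λ j → F i j)) + Σ≤ m (λ j → F (suc n) j) ≈⟨ +-congʳ (Σ≤-swap n m F) ⟩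
    Σ≤ m (λ j → Σ≤ n (λ i → F i j)) + Σ≤ m (λ j → F (suc n) j) ≈⟨ Σ≤-distrib-+ m _ _ ⟨
    Σ≤ m (λ j → Σ≤ (suc n) (λ i → F i j))                       ∎

  Σ≤-triangle : ∀ n (F : ℕ → ℕ → Carrier) →
    Σ≤ n (λ i → Σ≤ (n ∸ i) (λ j → F i j)) ≈ Σ≤ n (λ m → Σ≤ m (λ i → F i (m ∸ i)))
  Σ≤-triangle zero    F = refl
  Σ≤-triangle (suc n) F = begin
    Σ≤ (suc n) (λ i → Σ≤ (suc n ∸ i) (λ j → F i j))
      ≈⟨ Σ≤-head n _ ⟩
    Σ≤ (suc n) (F 0) + Σ≤ n (λ i → Σ≤ (n ∸ i) (λ j → F (suc i) j))
      ≈⟨ +-cong (Σ≤-head n (F 0)) (Σ≤-triangle n (λ i → F (suc i))) ⟩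
    (F 0 0 + Σ≤ n (λ m → F 0 (suc m))) + Σ≤ n (λ m → Σ≤ m (λ i → F (suc i) (m ∸ i)))
      ≈⟨ +-assoc _ _ _ ⟩
    F 0 0 + (Σ≤ n (λ m → F 0 (suc m)) + Σ≤ n (λ m → Σ≤ m (λ i → F (suc i) (m ∸ i))))
      ≈⟨ +-congˡ (Σ≤-distrib-+ n _ _) ⟨
    F 0 0 + Σ≤ n (λ m → F 0 (suc m) + Σ≤ m (λ i → F (suc i) (m ∸ i)))
      ≈⟨ +-congˡ (Σ≤-cong n (λ m → Σ≤-head m (λ i → F i (suc m ∸ i)))) ⟨
    F 0 0 + Σ≤ n (λ m → Σ≤ (suc m) (λ i → F i (suc m ∸ i)))
      ≈⟨ Σ≤-head n (λ m → Σ≤ m (λ i → F i (m ∸ i))) ⟨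
    Σ≤ (suc n) (λ m → Σ≤ m (λ i → F i (m ∸ i))) ∎

  infix 4 _≋_
  _≋_ : Series → Series → Set ℓ
  f ≋ g = ∀ n → f n ≈ g n

  ≋-sym : ∀ {f g} → f ≋ g → g ≋ f
  ≋-sym f≋g n = sym (f≋g n)

  ≋-trans : ∀ {f g h} → f ≋ g → g ≋ h → f ≋ h
  ≋-trans f≋g g≋h n = trans (f≋g n) (g≋h n)

  ⊛-congˡ : ∀ h {f g} → f ≋ g → h ⊛ f ≋ h ⊛ g
  ⊛-congˡ h f≋g n = Σ≤-cong n (λ i → *-congˡ (f≋g (n ∸ i)))

  ⊛-congʳ : ∀ h {f g} → f ≋ g → f ⊛ h ≋ g ⊛ h
  ⊛-congʳ h f≋g n = Σ≤-cong n (λ i → *-congʳ (f≋g i))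

  ⊛-comm : ∀ f g → f ⊛ g ≋ g ⊛ f
  ⊛-comm f g n = begin
    Σ≤ n (λ i → f i * g (n ∸ i))              ≈⟨ Σ≤-reverse n _ ⟩
    Σ≤ n (λ i → f (n ∸ i) * g (n ∸ (n ∸ i)))  ≈⟨ Σ≤-cong-≤ n (λ i≤n →
      trans (*-comm _ _) (*-congʳ (reflexive (≡.cong g (ℕₚ.m∸[m∸n]≡n i≤n))))) ⟩
    Σ≤ n (λ i → g i * f (n ∸ i))              ∎

  ⊛-assoc : ∀ f g h → (f ⊛ g) ⊛ h ≋ f ⊛ (g ⊛ h)
  ⊛-assoc f g h n = sym (begin
    Σ≤ n (λ i → f i * Σ≤ (n ∸ i) (λ j → g j * h (n ∸ i ∸ j)))
      ≈⟨ Σ≤-cong n (λ i → *-distribˡ-Σ≤ (n ∸ i) (f i) _) ⟩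
    Σ≤ n (λ i → Σ≤ (n ∸ i) (λ j → f i * (g j * h (n ∸ i ∸ j))))
      ≈⟨ Σ≤-triangle n (λ i j → f i * (g j * h (n ∸ i ∸ j))) ⟩
    Σ≤ n (λ m → Σ≤ m (λ i → f i * (g (m ∸ i) * h (n ∸ i ∸ (m ∸ i)))))
      ≈⟨ Σ≤-cong n (λ m → Σ≤-cong-≤ m (λ i≤m →
           trans (sym (*-assoc _ _ _)) (*-congˡ (reflexive (≡.cong h (n∸i∸[m∸i]≡n∸m i≤m)))))) ⟩
    Σ≤ n (λ m → Σ≤ m (λ i → (f i * g (m ∸ i)) * h (n ∸ m)))
      ≈⟨ Σ≤-cong n (λ m → *-distribʳ-Σ≤ m _ _) ⟨
    Σ≤ n (λ m → Σ≤ m (λ i → f i * g (m ∸ i)) * h (n ∸ m)) ∎)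
    where
    n∸i∸[m∸i]≡n∸m : ∀ {i m} → i ≤ m → n ∸ i ∸ (m ∸ i) ≡ n ∸ m
    n∸i∸[m∸i]≡n∸m {i} {m} i≤m =
      ≡.trans (ℕₚ.∸-+-assoc n i (m ∸ i)) (≡.cong (n ∸_) (ℕₚ.m+[n∸m]≡n i≤m))

  ⊛-lcomm : ∀ f g h → f ⊛ (g ⊛ h) ≋ g ⊛ (f ⊛ h)
  ⊛-lcomm f g h = ≋-trans (≋-sym (⊛-assoc f g h))
    (≋-trans (⊛-congʳ h (⊛-comm f g)) (⊛-assoc g f h))

  ⊛-distribʳ : ∀ f g h → (g ⊕ h) ⊛ f ≋ (g ⊛ f) ⊕ (h ⊛ f)
  ⊛-distribʳ f g h n = trans (Σ≤-cong n (λ i → distribʳ _ _ _)) (Σ≤-distrib-+ n _ _)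

  ⊛-identityˡ : ∀ f → oneS ⊛ f ≋ f
  ⊛-identityˡ f zero    = *-identityˡ _
  ⊛-identityˡ f (suc n) = begin
    Σ≤ (suc n) (λ i → oneS i * f (suc n ∸ i))    ≈⟨ Σ≤-head n _ ⟩
    1# * f (suc n) + Σ≤ n (λ i → 0# * f (n ∸ i))
      ≈⟨ +-cong (*-identityˡ _) (Σ≤-zero n (λ _ → zeroˡ _)) ⟩
    f (suc n) + 0#                               ≈⟨ +-identityʳ _ ⟩
    f (suc n)                                    ∎

  ⊛-scalarˡ : ∀ a f g → (a ·S f) ⊛ g ≋ a ·S (f ⊛ g)
  ⊛-scalarˡ a f g n = trans (Σ≤-cong n (λ i → *-assoc _ _ _)) (sym (*-distribˡ-Σ≤ n a _))

  ⊛-scalarʳ : ∀ a f g → f ⊛ (a ·S g) ≋ a ·S (f ⊛ g)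
  ⊛-scalarʳ a f g n = trans (Σ≤-cong n (λ i → *-lcomm _ _ _)) (sym (*-distribˡ-Σ≤ n a _))

  ∂ : Series → Series
  ∂ f n = fromℕ (suc n) * f (suc n)

  ∂-cong : ∀ {f g} → f ≋ g → ∂ f ≋ ∂ g
  ∂-cong f≋g n = *-congˡ (f≋g (suc n))

  ∂-oneS : ∀ n → ∂ oneS n ≈ 0#
  ∂-oneS n = zeroʳ _

  ∂⊛-as-Σ≤ : ∀ f g n → (∂ f ⊛ g) n ≈ Σ≤ (suc n) (λ i → fromℕ i * (f i * g (suc n ∸ i)))
  ∂⊛-as-Σ≤ f g n = sym (begin
    Σ≤ (suc n) (λ i → fromℕ i * (f i * g (suc n ∸ i)))
      ≈⟨ Σ≤-head n _ ⟩
    0# * (f 0 * g (suc n)) + Σ≤ n (λ i → fromℕ (suc i) * (f (suc i) * g (n ∸ i)))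
      ≈⟨ +-cong (zeroˡ _) (Σ≤-cong n (λ i → sym (*-assoc _ _ _))) ⟩
    0# + (∂ f ⊛ g) n
      ≈⟨ +-identityˡ _ ⟩
    (∂ f ⊛ g) n ∎)

  ⊛∂-as-Σ≤ : ∀ f g n → (f ⊛ ∂ g) n ≈ Σ≤ (suc n) (λ i → fromℕ (suc n ∸ i) * (f i * g (suc n ∸ i)))
  ⊛∂-as-Σ≤ f g n = begin
    Σ≤ n (λ i → f i * (fromℕ (suc (n ∸ i)) * g (suc (n ∸ i))))
      ≈⟨ Σ≤-cong-≤ n (λ {i} i≤n → trans (*-lcomm _ _ _)
           (reflexive (≡.cong (λ k → fromℕ k * (f i * g k)) (≡.sym (ℕₚ.+-∸-assoc 1 i≤n))))) ⟩
    Σ≤ n (λ i → fromℕ (suc n ∸ i) * (f i * g (suc n ∸ i)))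
      ≈⟨ +-identityʳ _ ⟨
    Σ≤ n (λ i → fromℕ (suc n ∸ i) * (f i * g (suc n ∸ i))) + 0#
      ≈⟨ +-congˡ (trans (*-congʳ (reflexive (≡.cong fromℕ (ℕₚ.n∸n≡0 n)))) (zeroˡ _)) ⟨
    Σ≤ (suc n) (λ i → fromℕ (suc n ∸ i) * (f i * g (suc n ∸ i))) ∎

  ∂-⊛ : ∀ f g → ∂ (f ⊛ g) ≋ (∂ f ⊛ g) ⊕ (f ⊛ ∂ g)
  ∂-⊛ f g n = begin
    fromℕ (suc n) * Σ≤ (suc n) a
      ≈⟨ *-distribˡ-Σ≤ (suc n) _ a ⟩
    Σ≤ (suc n) (λ i → fromℕ (suc n) * a i)
      ≈⟨ Σ≤-cong-≤ (suc n) split ⟩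
    Σ≤ (suc n) (λ i → fromℕ i * a i + fromℕ (suc n ∸ i) * a i)
      ≈⟨ Σ≤-distrib-+ (suc n) _ _ ⟩
    Σ≤ (suc n) (λ i → fromℕ i * a i) + Σ≤ (suc n) (λ i → fromℕ (suc n ∸ i) * a i)
      ≈⟨ +-cong (∂⊛-as-Σ≤ f g n) (⊛∂-as-Σ≤ f g n) ⟨
    (∂ f ⊛ g) n + (f ⊛ ∂ g) n ∎
    where
    a : ℕ → Carrier
    a i = f i * g (suc n ∸ i)
    split : ∀ {i} → i ≤ suc n → fromℕ (suc n) * a i ≈ fromℕ i * a i + fromℕ (suc n ∸ i) * a i
    split {i} i≤1+n = begin
      fromℕ (suc n) * a i
        ≡⟨ ≡.cong (λ m → fromℕ m * a i) (≡.sym (ℕₚ.m+[n∸m]≡n i≤1+n)) ⟩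
      fromℕ (i ℕ.+ (suc n ∸ i)) * a i
        ≈⟨ *-congʳ (fromℕ-+ i _) ⟩
      (fromℕ i + fromℕ (suc n ∸ i)) * a i
        ≈⟨ distribʳ _ _ _ ⟩
      fromℕ i * a i + fromℕ (suc n ∸ i) * a i ∎

  ∂-powS : ∀ h k → ∂ (powS h (suc k)) ≋ fromℕ (suc k) ·S (∂ h ⊛ powS h k)
  ∂-powS h zero n = begin
    ∂ (h ⊛ oneS) n
      ≈⟨ ∂-⊛ h oneS n ⟩
    (∂ h ⊛ oneS) n + (h ⊛ ∂ oneS) n
      ≈⟨ +-congˡ (Σ≤-zero n (λ {i} _ → trans (*-congˡ (∂-oneS (n ∸ i))) (zeroʳ (h i)))) ⟩
    (∂ h ⊛ oneS) n + 0#
      ≈⟨ +-identityʳ _ ⟩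
    (∂ h ⊛ oneS) n
      ≈⟨ fromℕ-1* _ ⟨
    fromℕ 1 * (∂ h ⊛ oneS) n ∎
  ∂-powS h (suc k) n = begin
    ∂ (h ⊛ hᵏ⁺¹) n
      ≈⟨ ∂-⊛ h hᵏ⁺¹ n ⟩
    (∂ h ⊛ hᵏ⁺¹) n + (h ⊛ ∂ hᵏ⁺¹) n
      ≈⟨ +-congˡ (⊛-congˡ h (∂-powS h k) n) ⟩
    (∂ h ⊛ hᵏ⁺¹) n + (h ⊛ (s ·S (∂ h ⊛ powS h k))) n
      ≈⟨ +-congˡ (⊛-scalarʳ s h (∂ h ⊛ powS h k) n) ⟩
    (∂ h ⊛ hᵏ⁺¹) n + s * (h ⊛ (∂ h ⊛ powS h k)) n
      ≈⟨ +-congˡ (*-congˡ (⊛-lcomm h (∂ h) (powS h k) n)) ⟩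
    (∂ h ⊛ hᵏ⁺¹) n + s * (∂ h ⊛ hᵏ⁺¹) n
      ≈⟨ +-congʳ (*-identityˡ _) ⟨
    1# * (∂ h ⊛ hᵏ⁺¹) n + s * (∂ h ⊛ hᵏ⁺¹) n
      ≈⟨ distribʳ _ _ _ ⟨
    fromℕ (suc (suc k)) * (∂ h ⊛ hᵏ⁺¹) n ∎
    where
    hᵏ⁺¹ : Series
    hᵏ⁺¹ = powS h (suc k)
    s : Carrier
    s = fromℕ (suc k)

  powS-vanishes : ∀ h → h 0 ≈ 0# → ∀ k {n} → n < k → powS h k n ≈ 0#
  powS-vanishes h h0≈0 (suc k) {n} n<1+k = Σ≤-zero n (term n n<1+k)
    where
    term : ∀ m → m < suc k → ∀ {i} → i ≤ m → h i * powS h k (m ∸ i) ≈ 0#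
    term m       _         {zero}  _         = trans (*-congʳ h0≈0) (zeroˡ _)
    term (suc m) (s≤s m<k) {suc i} (s≤s i≤m) = trans
      (*-congˡ (powS-vanishes h h0≈0 k (ℕₚ.≤-<-trans (ℕₚ.m∸n≤m m i) m<k))) (zeroʳ _)

  -- compose a h = Σₖ aₖ hᵏ/k!, the exponential generating function of a
  -- evaluated at h; for h 0 ≈ 0# the terms k > n do not contribute to tⁿ.
  compose : (ℕ → Carrier) → Series → Series
  compose a h n = Σ≤ n (λ k → a k * (invFact k * powS h k n))

  compose-cong : ∀ h {a b} → (∀ k → a k ≈ b k) → compose a h ≋ compose b h
  compose-cong h a≈b n = Σ≤-cong n (λ k → *-congʳ (a≈b k))

  compose-+ : ∀ h a b → compose (λ k → a k + b k) h ≋ compose a h ⊕ compose b h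
  compose-+ h a b n = trans (Σ≤-cong n (λ k → distribʳ _ _ _)) (Σ≤-distrib-+ n _ _)

  compose-* : ∀ h x a → compose (λ k → x * a k) h ≋ x ·S compose a h
  compose-* h x a n = trans (Σ≤-cong n (λ k → *-assoc _ _ _)) (sym (*-distribˡ-Σ≤ n x _))

  module _ (h : Series) (h0≈0 : h 0 ≈ 0#) where

    compose-extend : ∀ (a : ℕ → Carrier) {n N} → n ≤ N →
      compose a h n ≈ Σ≤ N (λ k → a k * (invFact k * powS h k n))
    compose-extend a n≤N = sym (Σ≤-extend _ n≤N (λ {k} n<k →
      trans (*-congˡ (trans (*-congˡ (powS-vanishes h h0≈0 k n<k)) (zeroʳ _))) (zeroʳ _)))

    ⊛-compose : ∀ f (b : ℕ → Carrier) n →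
      (f ⊛ compose b h) n ≈ Σ≤ n (λ k → b k * (invFact k * (f ⊛ powS h k) n))
    ⊛-compose f b n = begin
      Σ≤ n (λ i → f i * compose b h (n ∸ i))
        ≈⟨ Σ≤-cong n (λ i → *-congˡ (compose-extend b (ℕₚ.m∸n≤m n i))) ⟩
      Σ≤ n (λ i → f i * Σ≤ n (λ k → b k * (invFact k * powS h k (n ∸ i))))
        ≈⟨ Σ≤-cong n (λ i → *-distribˡ-Σ≤ n (f i) _) ⟩
      Σ≤ n (λ i → Σ≤ n (λ k → f i * (b k * (invFact k * powS h k (n ∸ i)))))
        ≈⟨ Σ≤-swap n n _ ⟩
      Σ≤ n (λ k → Σ≤ n (λ i → f i * (b k * (invFact k * powS h k (n ∸ i)))))
        ≈⟨ Σ≤-cong n (λ k → Σ≤-cong n (λ i →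
             trans (*-lcomm _ _ _) (*-congˡ (*-lcomm _ _ _)))) ⟩
      Σ≤ n (λ k → Σ≤ n (λ i → b k * (invFact k * (f i * powS h k (n ∸ i)))))
        ≈⟨ Σ≤-cong n (λ k → trans (sym (*-distribˡ-Σ≤ n (b k) _))
             (*-congˡ (sym (*-distribˡ-Σ≤ n (invFact k) _)))) ⟩
      Σ≤ n (λ k → b k * (invFact k * (f ⊛ powS h k) n)) ∎

    ∂-compose : ∀ (a : ℕ → Carrier) → ∂ (compose a h) ≋ ∂ h ⊛ compose (λ k → a (suc k)) h
    ∂-compose a n = begin
      fromℕ (suc n) * Σ≤ (suc n) (λ k → a k * (invFact k * powS h k (suc n)))
        ≈⟨ *-distribˡ-Σ≤ (suc n) _ _ ⟩
      Σ≤ (suc n) (λ k → fromℕ (suc n) * (a k * (invFact k * powS h k (suc n))))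
        ≈⟨ Σ≤-cong (suc n) (λ k → trans (*-lcomm _ _ _) (*-congˡ (*-lcomm _ _ _))) ⟩
      Σ≤ (suc n) (λ k → a k * (invFact k * ∂ (powS h k) n))
        ≈⟨ Σ≤-head n _ ⟩
      a 0 * (invFact 0 * ∂ oneS n)
        + Σ≤ n (λ k → a (suc k) * (invFact (suc k) * ∂ (powS h (suc k)) n))
        ≈⟨ +-cong (trans (*-congˡ (trans (*-congˡ (∂-oneS n)) (zeroʳ _))) (zeroʳ _))
                  (Σ≤-cong n (λ k → *-congˡ (trans (*-congˡ (∂-powS h k n))
                                                    (invFact-suc-cancelˡ k _)))) ⟩
      0# + Σ≤ n (λ k → a (suc k) * (invFact k * (∂ h ⊛ powS h k) n))
        ≈⟨ +-identityˡ _ ⟩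
      Σ≤ n (λ k → a (suc k) * (invFact k * (∂ h ⊛ powS h k) n))
        ≈⟨ ⊛-compose (∂ h) (λ k → a (suc k)) n ⟨
      (∂ h ⊛ compose (λ k → a (suc k)) h) n ∎

    ⊛-compose-suc : ∀ (a : ℕ → Carrier) → h ⊛ compose (λ k → a (suc k)) h ≋ compose (λ k → fromℕ k * a k) h
    ⊛-compose-suc a n = begin
      (h ⊛ compose (λ k → a (suc k)) h) n
        ≈⟨ ⊛-compose h (λ k → a (suc k)) n ⟩
      Σ≤ n (λ k → a (suc k) * (invFact k * powS h (suc k) n))
        ≈⟨ Σ≤-cong n (λ k → *-congˡ (invFact-suc-cancelˡ k _)) ⟨
      Σ≤ n (λ k → a (suc k) * (invFact (suc k) * (fromℕ (suc k) * powS h (suc k) n)))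
        ≈⟨ Σ≤-cong n (λ k → trans (*-congˡ (*-lcomm _ _ _)) (sym (*-assoc _ _ _))) ⟩
      Σ≤ n (λ k → (a (suc k) * fromℕ (suc k)) * (invFact (suc k) * powS h (suc k) n))
        ≈⟨ Σ≤-cong n (λ k → *-congʳ (*-comm _ _)) ⟩
      Σ≤ n (λ k → (fromℕ (suc k) * a (suc k)) * (invFact (suc k) * powS h (suc k) n))
        ≈⟨ +-identityˡ _ ⟨
      0# + Σ≤ n (λ k → (fromℕ (suc k) * a (suc k)) * (invFact (suc k) * powS h (suc k) n))
        ≈⟨ +-congʳ (trans (*-congʳ (zeroˡ _)) (zeroˡ _)) ⟨
      (fromℕ 0 * a 0) * (invFact 0 * powS h 0 n)
        + Σ≤ n (λ k → (fromℕ (suc k) * a (suc k)) * (invFact (suc k) * powS h (suc k) n))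
        ≈⟨ Σ≤-head n _ ⟨
      Σ≤ (suc n) (λ k → (fromℕ k * a k) * (invFact k * powS h k n))
        ≈⟨ compose-extend (λ k → fromℕ k * a k) (ℕₚ.n≤1+n n) ⟨
      compose (λ k → fromℕ k * a k) h n ∎

    ∂-expS : ∂ (expS h) ≋ ∂ h ⊛ expS h
    ∂-expS n = begin
      ∂ (expS h) n                       ≈⟨ ∂-cong expS≋compose n ⟩
      ∂ (compose (λ _ → 1#) h) n         ≈⟨ ∂-compose (λ _ → 1#) n ⟩
      (∂ h ⊛ compose (λ _ → 1#) h) n     ≈⟨ ⊛-congˡ (∂ h) expS≋compose n ⟨
      (∂ h ⊛ expS h) n                   ∎
      where
      expS≋compose : expS h ≋ compose (λ _ → 1#) h
      expS≋compose n = Σ≤-cong n (λ k → sym (*-identityˡ _))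

  ∂-⊛-solutions : ∀ {f g} F G → ∂ F ≋ f ⊛ F → ∂ G ≋ g ⊛ G → ∂ (F ⊛ G) ≋ (f ⊕ g) ⊛ (F ⊛ G)
  ∂-⊛-solutions {f} {g} F G ∂F ∂G n = begin
    ∂ (F ⊛ G) n                               ≈⟨ ∂-⊛ F G n ⟩
    (∂ F ⊛ G) n + (F ⊛ ∂ G) n                 ≈⟨ +-cong (⊛-congʳ G ∂F n) (⊛-congˡ F ∂G n) ⟩
    ((f ⊛ F) ⊛ G) n + (F ⊛ (g ⊛ G)) n         ≈⟨ +-cong (⊛-assoc f F G n) (⊛-lcomm F g G n) ⟩
    (f ⊛ (F ⊛ G)) n + (g ⊛ (F ⊛ G)) n         ≈⟨ ⊛-distribʳ (F ⊛ G) f g n ⟨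
    ((f ⊕ g) ⊛ (F ⊛ G)) n                     ∎

  -- Comparing coefficients in F′ = g F determines F (n+1) from F 0, …, F n,
  -- because n+1 is invertible.
  solutions-unique : ∀ g F G → ∂ F ≋ g ⊛ F → ∂ G ≋ g ⊛ G → F 0 ≈ G 0 → F ≋ G
  solutions-unique g F G ∂F ∂G F0≈G0 n = agree n ℕₚ.≤-refl
    where
    agree : ∀ n {m} → m ≤ n → F m ≈ G m
    agree zero    z≤n  = F0≈G0
    agree (suc n) m≤1+n with ℕₚ.m≤n⇒m<n∨m≡n m≤1+n
    ... | inj₁ (s≤s m≤n) = agree n m≤n
    ... | inj₂ ≡.refl    = begin
      F (suc n)          ≈⟨ inv-cancelˡ n _ ⟨
      inv n * ∂ F n      ≈⟨ *-congˡ (∂F n) ⟩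
      inv n * (g ⊛ F) n  ≈⟨ *-congˡ (Σ≤-cong n (λ i → *-congˡ (agree n (ℕₚ.m∸n≤m n i)))) ⟩
      inv n * (g ⊛ G) n  ≈⟨ *-congˡ (∂G n) ⟨
      inv n * ∂ G n      ≈⟨ inv-cancelˡ n _ ⟩
      G (suc n)          ∎

  ∂-expM1 : ∂ expM1 ≋ oneS ⊕ expM1
  ∂-expM1 zero    = trans (fromℕ-suc*invFact-suc 0) (sym (+-identityʳ _))
  ∂-expM1 (suc n) = trans (fromℕ-suc*invFact-suc (suc n)) (sym (+-identityˡ _))

  fallingExpansion : Carrier → Series
  fallingExpansion x = compose (falling x) expM1

  -- (x)ₖ₊₁ + k (x)ₖ = x (x)ₖ is what makes the derivative close up.
  ∂-fallingExpansion : ∀ x → ∂ (fallingExpansion x) ≋ (x ·S oneS) ⊛ fallingExpansion x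
  ∂-fallingExpansion x n = begin
    ∂ (fallingExpansion x) n
      ≈⟨ ∂-compose expM1 refl (falling x) n ⟩
    (∂ expM1 ⊛ Y′) n
      ≈⟨ ⊛-congʳ Y′ ∂-expM1 n ⟩
    ((oneS ⊕ expM1) ⊛ Y′) n
      ≈⟨ ⊛-distribʳ Y′ oneS expM1 n ⟩
    (oneS ⊛ Y′) n + (expM1 ⊛ Y′) n
      ≈⟨ +-cong (⊛-identityˡ Y′ n) (⊛-compose-suc expM1 refl (falling x) n) ⟩
    Y′ n + compose (λ k → fromℕ k * falling x k) expM1 n
      ≈⟨ compose-+ expM1 (λ k → falling x (suc k)) (λ k → fromℕ k * falling x k) n ⟨
    compose (λ k → falling x (suc k) + fromℕ k * falling x k) expM1 n
      ≈⟨ compose-cong expM1 (x*falling x) n ⟨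
    compose (λ k → x * falling x k) expM1 n
      ≈⟨ compose-* expM1 x (falling x) n ⟩
    x * fallingExpansion x n
      ≈⟨ *-congˡ (⊛-identityˡ (fallingExpansion x) n) ⟨
    x * (oneS ⊛ fallingExpansion x) n
      ≈⟨ ⊛-scalarˡ x oneS (fallingExpansion x) n ⟨
    ((x ·S oneS) ⊛ fallingExpansion x) n ∎
    where
    Y′ : Series
    Y′ = compose (λ k → falling x (suc k)) expM1

  module _ (y : Carrier) where

    exponent : Carrier → Series
    exponent x = linS x ⊕ (y ·S expM1)

    ∂-exponent : ∀ x → ∂ (exponent x) ≋ (x ·S oneS) ⊕ (y ·S ∂ expM1)
    ∂-exponent x zero    = trans (distribˡ _ _ _)
      (+-cong (trans (fromℕ-1* x) (sym (*-identityʳ x))) (*-lcomm _ _ _))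
    ∂-exponent x (suc n) = trans (distribˡ _ _ _)
      (+-cong (trans (zeroʳ _) (sym (zeroʳ x))) (*-lcomm _ _ _))

    ∂-expS-exponent : ∀ x →
      ∂ (expS (exponent x)) ≋ ((x ·S oneS) ⊕ (y ·S ∂ expM1)) ⊛ expS (exponent x)
    ∂-expS-exponent x n = trans (∂-expS (exponent x) (trans (+-identityˡ _) (zeroʳ y)) n)
      (⊛-congʳ (expS (exponent x)) (∂-exponent x) n)

    expS-exponent-factorises : ∀ x →
      expS (exponent x) ≋ fallingExpansion x ⊛ expS (exponent 0#)
    expS-exponent-factorises x = solutions-unique _ (expS (exponent x)) (Y ⊛ E₀)
      (∂-expS-exponent x) (∂-⊛-solutions Y E₀ (∂-fallingExpansion x) ∂E₀) constant-terms
      where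
      Y E₀ : Series
      Y = fallingExpansion x
      E₀ = expS (exponent 0#)
      ∂E₀ : ∂ E₀ ≋ (y ·S ∂ expM1) ⊛ E₀
      ∂E₀ n = trans (∂-expS-exponent 0# n)
        (⊛-congʳ E₀ (λ m → trans (+-congʳ (zeroˡ _)) (+-identityˡ _)) n)
      constant-terms : expS (exponent x) 0 ≈ (Y ⊛ E₀) 0
      constant-terms = sym (trans (*-congʳ (trans (*-identityˡ _) (*-identityˡ _))) (*-identityˡ _))

  genBE-factorises : ∀ α x y → genBE α x y ≋ fallingExpansion x ⊛ genBE α 0# y
  genBE-factorises α x y = ≋-trans
    (⊛-congˡ (powα twoOverEt+1 α) (expS-exponent-factorises y x))
    (⊛-lcomm (powα twoOverEt+1 α) (fallingExpansion x) (expS (exponent y 0#)))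

  fact*⊛-as-binomial-sum : ∀ F G n →
    fact n * (F ⊛ G) n ≈ Σ≤ n (λ j → binomN n j * (fact j * F j) * (fact (n ∸ j) * G (n ∸ j)))
  fact*⊛-as-binomial-sum F G n = begin
    fact n * Σ≤ n (λ j → F j * G (n ∸ j))
      ≈⟨ *-distribˡ-Σ≤ n _ _ ⟩
    Σ≤ n (λ j → fact n * (F j * G (n ∸ j)))
      ≈⟨ Σ≤-cong-≤ n (λ j≤n → *-congʳ (binomN*fact*fact j≤n)) ⟨
    Σ≤ n (λ j → (binomN n j * (fact j * fact (n ∸ j))) * (F j * G (n ∸ j)))
      ≈⟨ Σ≤-cong n (λ j → rearrange _ _ _ _ _) ⟩
    Σ≤ n (λ j → binomN n j * (fact j * F j) * (fact (n ∸ j) * G (n ∸ j))) ∎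
    where
    rearrange : ∀ b p q u v → (b * (p * q)) * (u * v) ≈ (b * (p * u)) * (q * v)
    rearrange b p q u v = begin
      (b * (p * q)) * (u * v) ≈⟨ *-assoc _ _ _ ⟩
      b * ((p * q) * (u * v)) ≈⟨ *-congˡ (*-interchange p q u v) ⟩
      b * ((p * u) * (q * v)) ≈⟨ *-assoc _ _ _ ⟨
      (b * (p * u)) * (q * v) ∎

  fact*fallingExpansion : ∀ x j → fact j * fallingExpansion x j ≈ Σ≤ j (λ k → falling x k * S2 j k)
  fact*fallingExpansion x j =
    trans (*-distribˡ-Σ≤ j _ _) (Σ≤-cong j (λ k → *-lcomm _ _ _))

mainTheorem7 : ∀ {c ℓ} (A : QAlgebra c ℓ) →
    let open Ops A in
    ∀ (α x y : Carrier) (n : ℕ) →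
      BE α n x y ≈
        Σ≤ n (λ j → Σ≤ j (λ k →
          binomN n j * falling x k * S2 j k * BE₀ α (n ∸ j) y))
mainTheorem7 A α x y n = begin
  fact n * genBE α x y n
    ≈⟨ *-congˡ (genBE-factorises A α x y n) ⟩
  fact n * (fallingExpansion A x ⊛ genBE α 0# y) n
    ≈⟨ fact*⊛-as-binomial-sum A (fallingExpansion A x) (genBE α 0# y) n ⟩
  Σ≤ n (λ j → binomN n j * (fact j * fallingExpansion A x j) * BE₀ α (n ∸ j) y)
    ≈⟨ Σ≤-cong A n (λ j → *-congʳ (*-congˡ (fact*fallingExpansion A x j))) ⟩
  Σ≤ n (λ j → binomN n j * Σ≤ j (λ k → falling x k * S2 j k) * BE₀ α (n ∸ j) y)
    ≈⟨ Σ≤-cong A n (λ j → trans (*-congʳ (*-distribˡ-Σ≤ A j _ _)) (*-distribʳ-Σ≤ A j _ _)) ⟩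
  Σ≤ n (λ j → Σ≤ j (λ k → binomN n j * (falling x k * S2 j k) * BE₀ α (n ∸ j) y))
    ≈⟨ Σ≤-cong A n (λ j → Σ≤-cong A j (λ k → *-congʳ (sym (*-assoc _ _ _)))) ⟩
  Σ≤ n (λ j → Σ≤ j (λ k → binomN n j * falling x k * S2 j k * BE₀ α (n ∸ j) y)) ∎
  where
  open Ops A
  open ≈-Reasoning setoid
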